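{- Let $k$ and $r$ be positive integers with $k\geq 2$ and $1\leq r<k-1$, such that $r$ does not divide $k-1$. Let $D$ be the diameter of $K(2k+r,k)$ and suppose $D=2p$ for an integer $p\geq1$. If $A$ and $B$ are two distinct vertices of $K_{=2p}(2k+r,k)$ which are not adjacent, then their distance in $K_{=2p}(2k+r,k)$ is $2$.
   Context: For positive integers $n,k$, $[n]^k$ is the set of $k$-element subsets of $\{1,\dots,n\}$. The Kneser graph $K(2k+r,k)$ has vertex set $[2k+r]^k$, with $A,B$ adjacent iff $A\cap B=\emptyset$; it is connected. For a connected graph $G$ and positive integer $d$, the exact distance-$d$ graph $G_{=d}$ has the same vertex set as $G$, with two vertices adjacent iff their distance in $G$ is exactly $d$. $K_{=d}(2k+r,k)$ denotes the exact distance-$d$ graph of $K(2k+r,k)$. (The diameter of $K(2k+r,k)$ is $\lceil (k-1)/r\rceil+1$.) -}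

module Defs where

open import Data.Nat using (ℕ; zero; suc; _+_; _<_; _≤_)
open import Data.Product using (Σ; ∃; ∃-syntax; _×_; _,_)
open import Data.Fin.Subset using (Subset; ∣_∣; _∩_; Empty)
open import Relation.Binary.PropositionalEquality using (_≡_)
open import Relation.Nullary using (¬_)

data Walk {V : Set} (adj : V → V → Set) : ℕ → V → V → Set where
  here : ∀ {x} → Walk adj zero x x
  step : ∀ {ℓ x y z} → adj x y → Walk adj ℓ y z → Walk adj (suc ℓ) x z

Dist : {V : Set} → (V → V → Set) → V → V → ℕ → Set
Dist adj x y d = Walk adj d x y × (∀ m → m < d → ¬ Walk adj m x y)

IsDiameter : {V : Set} → (V → V → Set) → ℕ → Set
IsDiameter {V} adj D =
  (∀ x y → ∃[ m ] (m ≤ D × Dist adj x y m)) × (∃[ x ] ∃[ y ] Dist adj x y D)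

KVertex : ℕ → ℕ → Set
KVertex n k = Σ (Subset n) (λ A → ∣ A ∣ ≡ k)

KAdj : ∀ {n k} → KVertex n k → KVertex n k → Set
KAdj (A , _) (B , _) = Empty (A ∩ B)

ExactAdj : {V : Set} → (V → V → Set) → ℕ → V → V → Set
ExactAdj adj d x y = Dist adj x y d

-- Write s = ∣ X ∩ Y ∣ for vertices X, Y of K(2k+r, k).  If Z ~ Y, the elements C shares
-- with Z and with Y are disjoint and ∣ C ∪ Z ∪ Y ∣ ≤ 2k + r, so
-- ∣ Z ∩ C ∣ + ∣ Y ∩ C ∣ ≤ k ≤ ∣ Z ∩ C ∣ + ∣ Y ∩ C ∣ + r.  Along a walk, length 2t forces
-- k ≤ s + t r and length 2t + 1 forces s ≤ t r; conversely each bound is realised by a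
-- walk built one neighbour at a time, each chosen with prescribed intersections.  Hence
-- for D = 2(q+1) every pair with q r < s and s + q r < k is at distance at least, so
-- exactly, D.  A pair at distance D forces 2(qr+1) ≤ k (for q = 0 this is k ≥ 2), and D
-- bounding all distances forces k ≤ 2(qr+1) + r, as otherwise a vertex meeting a fixed
-- one in qr+1 elements would be farther away.  These two inequalities are exactly what
-- is needed to find, for any A and B, a vertex C meeting each in qr+1 elements; it is at
-- distance D from both.
module Submission where

open import Defs
open import Data.Bool.Base using (true; false)
import Data.Fin.Base as Fin
open import Data.Fin.Subset using (Subset; ∣_∣; _∩_; _∪_; _─_; ∁; Empty)
open import Data.Fin.Subset.Properties
  using (Empty-unique; ∣⊥∣≡0; ∣p∣≤n; ∣∁p∣≡n∸∣p∣; ∣p∩q∣≤∣p∣; ∣p∩q∣≤∣q∣;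
         ∩-comm; ∩-idem; ∩-distribʳ-∪; x∈p∩q⁺; p∩q⊆p; p∩q⊆q)
open import Data.Nat.Base using (ℕ; zero; suc; _+_; _*_; _∸_; _⊓_; _≤_; _<_; z≤n; s≤s; s≤s⁻¹)
open import Data.Nat.Divisibility using (_∣_)
open import Data.Nat.Properties
open import Data.Nat.Tactic.RingSolver using (solve-∀)
open import Data.Product.Base using (Σ-syntax; ∃-syntax; _×_; _,_; proj₁; proj₂)
open import Data.Vec.Base using ([]; _∷_; here; there)
open import Function.Base using (_∘_)
open import Relation.Binary.PropositionalEquality
open import Relation.Nullary using (¬_)

private variable n : ℕ

Empty⇒∣p∣≡0 : {p : Subset n} → Empty p → ∣ p ∣ ≡ 0
Empty⇒∣p∣≡0 {n} e = trans (cong ∣_∣ (Empty-unique e)) (∣⊥∣≡0 n)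

∣p∣≡0⇒Empty : (p : Subset n) → ∣ p ∣ ≡ 0 → Empty p
∣p∣≡0⇒Empty (true ∷ p) ()
∣p∣≡0⇒Empty (false ∷ p) ∣p∣≡0 (Fin.zero , ())
∣p∣≡0⇒Empty (false ∷ p) ∣p∣≡0 (Fin.suc i , there i∈p) = ∣p∣≡0⇒Empty p ∣p∣≡0 (i , i∈p)

∣p∪q∣+∣p∩q∣≡∣p∣+∣q∣ : (p q : Subset n) → ∣ p ∪ q ∣ + ∣ p ∩ q ∣ ≡ ∣ p ∣ + ∣ q ∣
∣p∪q∣+∣p∩q∣≡∣p∣+∣q∣ [] [] = refl
∣p∪q∣+∣p∩q∣≡∣p∣+∣q∣ (true ∷ p) (true ∷ q) =
  cong suc (trans (+-suc _ _) (trans (cong suc (∣p∪q∣+∣p∩q∣≡∣p∣+∣q∣ p q)) (sym (+-suc _ _))))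
∣p∪q∣+∣p∩q∣≡∣p∣+∣q∣ (true ∷ p) (false ∷ q) = cong suc (∣p∪q∣+∣p∩q∣≡∣p∣+∣q∣ p q)
∣p∪q∣+∣p∩q∣≡∣p∣+∣q∣ (false ∷ p) (true ∷ q) =
  trans (cong suc (∣p∪q∣+∣p∩q∣≡∣p∣+∣q∣ p q)) (sym (+-suc _ _))
∣p∪q∣+∣p∩q∣≡∣p∣+∣q∣ (false ∷ p) (false ∷ q) = ∣p∪q∣+∣p∩q∣≡∣p∣+∣q∣ p q

∣p─q∣+∣p∩q∣≡∣p∣ : (p q : Subset n) → ∣ p ─ q ∣ + ∣ p ∩ q ∣ ≡ ∣ p ∣
∣p─q∣+∣p∩q∣≡∣p∣ [] [] = refl
∣p─q∣+∣p∩q∣≡∣p∣ (true ∷ p) (true ∷ q) = trans (+-suc _ _) (cong suc (∣p─q∣+∣p∩q∣≡∣p∣ p q))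
∣p─q∣+∣p∩q∣≡∣p∣ (true ∷ p) (false ∷ q) = cong suc (∣p─q∣+∣p∩q∣≡∣p∣ p q)
∣p─q∣+∣p∩q∣≡∣p∣ (false ∷ p) (true ∷ q) = ∣p─q∣+∣p∩q∣≡∣p∣ p q
∣p─q∣+∣p∩q∣≡∣p∣ (false ∷ p) (false ∷ q) = ∣p─q∣+∣p∩q∣≡∣p∣ p q

∣∁p∣+∣p∣≡n : (p : Subset n) → ∣ ∁ p ∣ + ∣ p ∣ ≡ n
∣∁p∣+∣p∣≡n p = trans (cong (_+ ∣ p ∣) (∣∁p∣≡n∸∣p∣ p)) (m∸n+n≡m (∣p∣≤n p))

∣p∣+∣q∣≤n+∣p∩q∣ : (p q : Subset n) → ∣ p ∣ + ∣ q ∣ ≤ n + ∣ p ∩ q ∣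
∣p∣+∣q∣≤n+∣p∩q∣ {n} p q =
  subst (_≤ n + ∣ p ∩ q ∣) (∣p∪q∣+∣p∩q∣≡∣p∣+∣q∣ p q) (+-monoˡ-≤ ∣ p ∩ q ∣ (∣p∣≤n (p ∪ q)))

∣p∪q∣≡∣p∣+∣q∣ : {p q : Subset n} → Empty (p ∩ q) → ∣ p ∪ q ∣ ≡ ∣ p ∣ + ∣ q ∣
∣p∪q∣≡∣p∣+∣q∣ {p = p} {q} p∩q=∅ = begin
  ∣ p ∪ q ∣               ≡⟨ +-identityʳ _ ⟨
  ∣ p ∪ q ∣ + 0           ≡⟨ cong (∣ p ∪ q ∣ +_) (Empty⇒∣p∣≡0 p∩q=∅) ⟨
  ∣ p ∪ q ∣ + ∣ p ∩ q ∣   ≡⟨ ∣p∪q∣+∣p∩q∣≡∣p∣+∣q∣ p q ⟩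
  ∣ p ∣ + ∣ q ∣           ∎
  where open ≡-Reasoning

∣[p∪q]∩s∣≡∣p∩s∣+∣q∩s∣ : {p q : Subset n} (s : Subset n) → Empty (p ∩ q) →
                        ∣ (p ∪ q) ∩ s ∣ ≡ ∣ p ∩ s ∣ + ∣ q ∩ s ∣
∣[p∪q]∩s∣≡∣p∩s∣+∣q∩s∣ {p = p} {q} s p∩q=∅ =
  trans (cong ∣_∣ (∩-distribʳ-∪ s p q)) (∣p∪q∣≡∣p∣+∣q∣ disjoint)
  where
  disjoint : Empty ((p ∩ s) ∩ (q ∩ s))
  disjoint (i , i∈) =
    p∩q=∅ (i , x∈p∩q⁺ (p∩q⊆p p s (p∩q⊆p _ _ i∈) , p∩q⊆p q s (p∩q⊆q _ _ i∈)))

subsetWithVennCounts :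
  (p q : Subset n) {a b c d : ℕ} →
  a ≤ ∣ p ∩ q ∣ → b ≤ ∣ p ─ q ∣ → c ≤ ∣ q ─ p ∣ → d ≤ ∣ ∁ (p ∪ q) ∣ →
  ∃[ s ] ∣ s ∣ ≡ a + b + c + d × ∣ p ∩ s ∣ ≡ a + b × ∣ q ∩ s ∣ ≡ a + c
subsetWithVennCounts [] [] z≤n z≤n z≤n z≤n = [] , refl , refl , refl
subsetWithVennCounts (true ∷ p) (true ∷ q) {zero} _ b≤ c≤ d≤
  with s , ∣s∣ , ∣p∩s∣ , ∣q∩s∣ ← subsetWithVennCounts p q z≤n b≤ c≤ d≤
  = false ∷ s , ∣s∣ , ∣p∩s∣ , ∣q∩s∣
subsetWithVennCounts (true ∷ p) (true ∷ q) {suc a} a≤ b≤ c≤ d≤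
  with s , ∣s∣ , ∣p∩s∣ , ∣q∩s∣ ← subsetWithVennCounts p q (s≤s⁻¹ a≤) b≤ c≤ d≤
  = true ∷ s , cong suc ∣s∣ , cong suc ∣p∩s∣ , cong suc ∣q∩s∣
subsetWithVennCounts (true ∷ p) (false ∷ q) {b = zero} a≤ _ c≤ d≤
  with s , ∣s∣ , ∣p∩s∣ , ∣q∩s∣ ← subsetWithVennCounts p q a≤ z≤n c≤ d≤
  = false ∷ s , ∣s∣ , ∣p∩s∣ , ∣q∩s∣
subsetWithVennCounts (true ∷ p) (false ∷ q) {a} {suc b} {c} {d} a≤ b≤ c≤ d≤
  with s , ∣s∣ , ∣p∩s∣ , ∣q∩s∣ ← subsetWithVennCounts p q a≤ (s≤s⁻¹ b≤) c≤ d≤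
  = true ∷ s , trans (cong suc ∣s∣) (cong (λ m → m + c + d) (sym (+-suc a b))) ,
    trans (cong suc ∣p∩s∣) (sym (+-suc a b)) , ∣q∩s∣
subsetWithVennCounts (false ∷ p) (true ∷ q) {c = zero} a≤ b≤ _ d≤
  with s , ∣s∣ , ∣p∩s∣ , ∣q∩s∣ ← subsetWithVennCounts p q a≤ b≤ z≤n d≤
  = false ∷ s , ∣s∣ , ∣p∩s∣ , ∣q∩s∣
subsetWithVennCounts (false ∷ p) (true ∷ q) {a} {b} {suc c} {d} a≤ b≤ c≤ d≤
  with s , ∣s∣ , ∣p∩s∣ , ∣q∩s∣ ← subsetWithVennCounts p q a≤ b≤ (s≤s⁻¹ c≤) d≤
  = true ∷ s , trans (cong suc ∣s∣) (cong (_+ d) (sym (+-suc (a + b) c))) ,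
    ∣p∩s∣ , trans (cong suc ∣q∩s∣) (sym (+-suc a c))
subsetWithVennCounts (false ∷ p) (false ∷ q) {d = zero} a≤ b≤ c≤ _
  with s , ∣s∣ , ∣p∩s∣ , ∣q∩s∣ ← subsetWithVennCounts p q a≤ b≤ c≤ z≤n
  = false ∷ s , ∣s∣ , ∣p∩s∣ , ∣q∩s∣
subsetWithVennCounts (false ∷ p) (false ∷ q) {a} {b} {c} {suc d} a≤ b≤ c≤ d≤
  with s , ∣s∣ , ∣p∩s∣ , ∣q∩s∣ ← subsetWithVennCounts p q a≤ b≤ c≤ (s≤s⁻¹ d≤)
  = true ∷ s , trans (cong suc ∣s∣) (sym (+-suc (a + b + c) d)) , ∣p∩s∣ , ∣q∩s∣

-- Halves are written t * 2 rather than 2 * t because suc t * 2 reduces to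
-- suc (suc (t * 2)), matching a walk that takes two more steps.
data EvenOdd : ℕ → Set where
  even : ∀ t → EvenOdd (t * 2)
  odd  : ∀ t → EvenOdd (suc (t * 2))

evenOdd : ∀ m → EvenOdd m
evenOdd zero = even 0
evenOdd (suc m) with evenOdd m
... | even t = odd t
... | odd t  = even (suc t)

module KneserGraph (k r : ℕ) where

  V : Set
  V = KVertex (2 * k + r) k

  adj : V → V → Set
  adj = KAdj {2 * k + r} {k}

  common : V → V → ℕ
  common X Y = ∣ proj₁ X ∩ proj₁ Y ∣

  common-comm : ∀ X Y → common X Y ≡ common Y X
  common-comm X Y = cong ∣_∣ (∩-comm (proj₁ X) (proj₁ Y))

  common≤k : ∀ X Y → common X Y ≤ k
  common≤k (x , ∣x∣≡k) (y , _) = subst (∣ x ∩ y ∣ ≤_) ∣x∣≡k (∣p∩q∣≤∣p∣ x y)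

  common-self : ∀ X → common X X ≡ k
  common-self (x , ∣x∣≡k) = trans (cong ∣_∣ (∩-idem x)) ∣x∣≡k

  common≡0⇒adj : ∀ X Y → common X Y ≡ 0 → adj X Y
  common≡0⇒adj X Y = ∣p∣≡0⇒Empty (proj₁ X ∩ proj₁ Y)

  module _ {Z Y : V} (Z~Y : adj Z Y) (C : V) where

    private
      z∪y = proj₁ Z ∪ proj₁ Y

      ∣z∪y∣≡k+k : ∣ z∪y ∣ ≡ k + k
      ∣z∪y∣≡k+k = trans (∣p∪q∣≡∣p∣+∣q∣ Z~Y) (cong₂ _+_ (proj₂ Z) (proj₂ Y))

      ∣[z∪y]∩c∣≡commons : ∣ z∪y ∩ proj₁ C ∣ ≡ common Z C + common Y C
      ∣[z∪y]∩c∣≡commons = ∣[p∪q]∩s∣≡∣p∩s∣+∣q∩s∣ (proj₁ C) Z~Y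

    adj⇒common+common≤k : common Z C + common Y C ≤ k
    adj⇒common+common≤k = begin
      common Z C + common Y C  ≡⟨ ∣[z∪y]∩c∣≡commons ⟨
      ∣ z∪y ∩ proj₁ C ∣        ≤⟨ ∣p∩q∣≤∣q∣ z∪y (proj₁ C) ⟩
      ∣ proj₁ C ∣              ≡⟨ proj₂ C ⟩
      k                        ∎
      where open ≤-Reasoning

    adj⇒k≤common+common+r : k ≤ common Z C + common Y C + r
    adj⇒k≤common+common+r = +-cancelˡ-≤ (k + k) _ _ (begin
      k + k + k                              ≡⟨ cong₂ _+_ ∣z∪y∣≡k+k (proj₂ C) ⟨
      ∣ z∪y ∣ + ∣ proj₁ C ∣                  ≤⟨ ∣p∣+∣q∣≤n+∣p∩q∣ z∪y (proj₁ C) ⟩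
      2 * k + r + ∣ z∪y ∩ proj₁ C ∣          ≡⟨ cong (2 * k + r +_) ∣[z∪y]∩c∣≡commons ⟩
      2 * k + r + (common Z C + common Y C)  ≡⟨ regroup k r (common Z C + common Y C) ⟩
      k + k + (common Z C + common Y C + r)  ∎)
      where
      open ≤-Reasoning
      regroup : ∀ k r t → 2 * k + r + t ≡ k + k + (t + r)
      regroup = solve-∀

  evenWalk⇒k≤common+t*r : ∀ t {X Y} → Walk adj (t * 2) X Y → k ≤ common X Y + t * r
  oddWalk⇒common≤t*r : ∀ t {X Y} → Walk adj (suc (t * 2)) X Y → common X Y ≤ t * r

  evenWalk⇒k≤common+t*r zero {X} here =
    ≤-reflexive (sym (trans (+-identityʳ _) (common-self X)))
  evenWalk⇒k≤common+t*r (suc t) {X} {Y} (step {y = Z} X~Z Z⇝Y) = begin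
    k                            ≤⟨ adj⇒k≤common+common+r {X} {Z} X~Z Y ⟩
    common X Y + common Z Y + r  ≤⟨ +-monoˡ-≤ r (+-monoʳ-≤ (common X Y) (oddWalk⇒common≤t*r t Z⇝Y)) ⟩
    common X Y + t * r + r       ≡⟨ +-assoc (common X Y) (t * r) r ⟩
    common X Y + (t * r + r)     ≡⟨ cong (common X Y +_) (+-comm (t * r) r) ⟩
    common X Y + suc t * r       ∎
    where open ≤-Reasoning

  oddWalk⇒common≤t*r t {X} {Y} (step {y = Z} X~Z Z⇝Y) = +-cancelʳ-≤ (common Z Y) _ _ (begin
    common X Y + common Z Y  ≤⟨ adj⇒common+common≤k {X} {Z} X~Z Y ⟩
    k                        ≤⟨ evenWalk⇒k≤common+t*r t Z⇝Y ⟩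
    common Z Y + t * r       ≡⟨ +-comm (common Z Y) (t * r) ⟩
    t * r + common Z Y       ∎)
    where open ≤-Reasoning

  ≤∣X─Y∣ : ∀ X Y {b} → b + common X Y ≤ k → b ≤ ∣ proj₁ X ─ proj₁ Y ∣
  ≤∣X─Y∣ X Y {b} b+s≤k =
    +-cancelʳ-≤ (common X Y) b _ (subst (b + common X Y ≤_) (sym ∣x─y∣+s≡k) b+s≤k)
    where
    ∣x─y∣+s≡k : ∣ proj₁ X ─ proj₁ Y ∣ + common X Y ≡ k
    ∣x─y∣+s≡k = trans (∣p─q∣+∣p∩q∣≡∣p∣ (proj₁ X) (proj₁ Y)) (proj₂ X)

  ∣∁[X∪Y]∣≡r+common : ∀ X Y → ∣ ∁ (proj₁ X ∪ proj₁ Y) ∣ ≡ r + common X Y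
  ∣∁[X∪Y]∣≡r+common (x , ∣x∣≡k) (y , ∣y∣≡k) = +-cancelʳ-≡ (k + k) _ _ (begin
    ∣ ∁ (x ∪ y) ∣ + (k + k)                  ≡⟨ cong (∣ ∁ (x ∪ y) ∣ +_) ∣x∪y∣+s≡k+k ⟨
    ∣ ∁ (x ∪ y) ∣ + (∣ x ∪ y ∣ + ∣ x ∩ y ∣)  ≡⟨ +-assoc ∣ ∁ (x ∪ y) ∣ (∣ x ∪ y ∣) (∣ x ∩ y ∣) ⟨
    ∣ ∁ (x ∪ y) ∣ + ∣ x ∪ y ∣ + ∣ x ∩ y ∣    ≡⟨ cong (_+ ∣ x ∩ y ∣) (∣∁p∣+∣p∣≡n (x ∪ y)) ⟩
    2 * k + r + ∣ x ∩ y ∣                    ≡⟨ regroup k r ∣ x ∩ y ∣ ⟩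
    r + ∣ x ∩ y ∣ + (k + k)                  ∎)
    where
    open ≡-Reasoning
    ∣x∪y∣+s≡k+k : ∣ x ∪ y ∣ + ∣ x ∩ y ∣ ≡ k + k
    ∣x∪y∣+s≡k+k = trans (∣p∪q∣+∣p∩q∣≡∣p∣+∣q∣ x y) (cong₂ _+_ ∣x∣≡k ∣y∣≡k)
    regroup : ∀ k r s → 2 * k + r + s ≡ r + s + (k + k)
    regroup = solve-∀

  vertexWithCommons : (X Y : V) {a b c d : ℕ} →
    a ≤ common X Y → b + common X Y ≤ k → c + common Y X ≤ k → d ≤ r + common X Y →
    a + b + c + d ≡ k → Σ[ Z ∈ V ] common X Z ≡ a + b × common Y Z ≡ a + c
  vertexWithCommons X Y a≤s b+s≤k c+s≤k d≤r+s a+b+c+d≡k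
    with z , ∣z∣≡a+b+c+d , ∣x∩z∣≡a+b , ∣y∩z∣≡a+c ←
         subsetWithVennCounts (proj₁ X) (proj₁ Y) a≤s (≤∣X─Y∣ X Y b+s≤k) (≤∣X─Y∣ Y X c+s≤k)
                              (subst (_ ≤_) (sym (∣∁[X∪Y]∣≡r+common X Y)) d≤r+s)
    = (z , trans ∣z∣≡a+b+c+d a+b+c+d≡k) , ∣x∩z∣≡a+b , ∣y∩z∣≡a+c

  vertexWithCommon : ∀ X {ℓ} → ℓ ≤ k → Σ[ Z ∈ V ] common X Z ≡ ℓ
  vertexWithCommon X {ℓ} ℓ≤k =
    let Z , X∩Z≡ℓ+0 , _ =
          vertexWithCommons X X {ℓ} {0} {0} {k ∸ ℓ}
            (subst (ℓ ≤_) (sym (common-self X)) ℓ≤k) (common≤k X X) (common≤k X X) k∸ℓ≤r+k sum≡k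
    in Z , trans X∩Z≡ℓ+0 (+-identityʳ ℓ)
    where
    k∸ℓ≤r+k : k ∸ ℓ ≤ r + common X X
    k∸ℓ≤r+k = ≤-trans (m∸n≤m k ℓ) (subst (k ≤_) (cong (r +_) (sym (common-self X))) (m≤n+m k r))
    sum≡k : ℓ + 0 + 0 + (k ∸ ℓ) ≡ k
    sum≡k = trans (cong (_+ (k ∸ ℓ)) (trans (+-identityʳ (ℓ + 0)) (+-identityʳ ℓ))) (m+[n∸m]≡n ℓ≤k)

  neighbourWithCommon : ∀ X Y {c} → k ∸ (r + common X Y) ≤ c → c ≤ k ∸ common X Y →
                        Σ[ Z ∈ V ] adj X Z × common Y Z ≡ c
  neighbourWithCommon X Y {c} lower upper =
    let Z , X∩Z≡0 , Y∩Z≡c =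
          vertexWithCommons X Y {0} {0} {c} {k ∸ c} z≤n (common≤k X Y) c+s≤k
            (m≤n+o⇒m∸n≤o k c k≤c+[r+s]) (m+[n∸m]≡n (≤-trans (m≤m+n c _) c+s≤k))
    in Z , common≡0⇒adj X Z X∩Z≡0 , Y∩Z≡c
    where
    s = common X Y
    c+s≤k : c + common Y X ≤ k
    c+s≤k = begin
      c + common Y X  ≡⟨ cong (c +_) (common-comm Y X) ⟩
      c + s           ≤⟨ +-monoˡ-≤ s upper ⟩
      k ∸ s + s       ≡⟨ m∸n+n≡m (common≤k X Y) ⟩
      k               ∎
      where open ≤-Reasoning
    k≤c+[r+s] : k ≤ c + (r + s)
    k≤c+[r+s] = begin
      k                      ≤⟨ m≤n+m∸n k (r + s) ⟩
      r + s + (k ∸ (r + s))  ≤⟨ +-monoʳ-≤ (r + s) lower ⟩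
      r + s + c              ≡⟨ +-comm (r + s) c ⟩
      c + (r + s)            ∎
      where open ≤-Reasoning

  k∸[r+common]≤k∸common : ∀ X Y → k ∸ (r + common X Y) ≤ k ∸ common X Y
  k∸[r+common]≤k∸common X Y = ∸-monoʳ-≤ k (m≤n+m (common X Y) r)

  k≤common+[1+t]*r⇒evenWalk : ∀ t {X Y} → k ≤ common X Y + suc t * r → Walk adj (suc t * 2) X Y
  common≤t*r⇒oddWalk : ∀ t {X Y} → common X Y ≤ t * r → Walk adj (suc (t * 2)) X Y

  k≤common+[1+t]*r⇒evenWalk t {X} {Y} k≤s+[1+t]r =
    let Z , X~Z , Y∩Z≡c = neighbourWithCommon X Y ≤-refl (k∸[r+common]≤k∸common X Y)
        Z∩Y≡c = trans (common-comm Z Y) Y∩Z≡c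
    in step {y = Z} X~Z (common≤t*r⇒oddWalk t (subst (_≤ t * r) (sym Z∩Y≡c) c≤t*r))
    where
    s = common X Y
    s+[1+t]r≡r+s+t*r : s + suc t * r ≡ r + s + t * r
    s+[1+t]r≡r+s+t*r = trans (sym (+-assoc s r (t * r))) (cong (_+ t * r) (+-comm s r))
    c≤t*r : k ∸ (r + s) ≤ t * r
    c≤t*r = m≤n+o⇒m∸n≤o k (r + s) (subst (k ≤_) s+[1+t]r≡r+s+t*r k≤s+[1+t]r)

  common≤t*r⇒oddWalk zero {X} {Y} s≤0 = step (common≡0⇒adj X Y (n≤0⇒n≡0 s≤0)) here
  common≤t*r⇒oddWalk (suc t) {X} {Y} s≤[1+t]r =
    let Z , X~Z , Y∩Z≡c = neighbourWithCommon X Y (k∸[r+common]≤k∸common X Y) ≤-refl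
        Z∩Y≡c = trans (common-comm Z Y) Y∩Z≡c
    in step {y = Z} X~Z
         (k≤common+[1+t]*r⇒evenWalk t (subst (λ c → k ≤ c + suc t * r) (sym Z∩Y≡c) k≤c+[1+t]r))
    where
    s = common X Y
    k≤c+[1+t]r : k ≤ k ∸ s + suc t * r
    k≤c+[1+t]r = subst (_≤ k ∸ s + suc t * r) (m∸n+n≡m (common≤k X Y)) (+-monoʳ-≤ (k ∸ s) s≤[1+t]r)

  equidistantVertex : ∀ A B {ℓ} → ℓ + ℓ ≤ k → k ≤ ℓ + ℓ + r →
                      Σ[ C ∈ V ] common A C ≡ ℓ × common B C ≡ ℓ
  equidistantVertex A B {ℓ} 2ℓ≤k k≤2ℓ+r =
    let C , A∩C≡m+[ℓ∸a] , B∩C≡m+[ℓ∸a] =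
          vertexWithCommons A B {m} {ℓ ∸ a} {ℓ ∸ a} {k ∸ (ℓ + ℓ) + m}
            (m⊓n≤m a ℓ) ℓ∸a+a≤k (subst (λ s → ℓ ∸ a + s ≤ k) (common-comm A B) ℓ∸a+a≤k)
            (+-mono-≤ (m≤n+o⇒m∸n≤o k (ℓ + ℓ) k≤2ℓ+r) (m⊓n≤m a ℓ)) sum≡k
    in C , trans A∩C≡m+[ℓ∸a] m+[ℓ∸a]≡ℓ , trans B∩C≡m+[ℓ∸a] m+[ℓ∸a]≡ℓ
    where
    a = common A B
    m = a ⊓ ℓ
    m+[ℓ∸a]≡ℓ : m + (ℓ ∸ a) ≡ ℓ
    m+[ℓ∸a]≡ℓ = m⊓n+n∸m≡n a ℓ
    ℓ∸a+a≤k : ℓ ∸ a + a ≤ k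
    ℓ∸a+a≤k = begin
      ℓ ∸ a + a  ≤⟨ +-monoˡ-≤ a (∸-monoˡ-≤ a (≤-trans (m≤m+n ℓ ℓ) 2ℓ≤k)) ⟩
      k ∸ a + a  ≡⟨ m∸n+n≡m (common≤k A B) ⟩
      k          ∎
      where open ≤-Reasoning
    regroup : ∀ m v e → m + v + v + (e + m) ≡ m + v + (m + v) + e
    regroup = solve-∀
    sum≡k : m + (ℓ ∸ a) + (ℓ ∸ a) + (k ∸ (ℓ + ℓ) + m) ≡ k
    sum≡k = begin
      m + (ℓ ∸ a) + (ℓ ∸ a) + (k ∸ (ℓ + ℓ) + m)    ≡⟨ regroup m (ℓ ∸ a) (k ∸ (ℓ + ℓ)) ⟩
      m + (ℓ ∸ a) + (m + (ℓ ∸ a)) + (k ∸ (ℓ + ℓ))  ≡⟨ cong (λ x → x + x + (k ∸ (ℓ + ℓ))) m+[ℓ∸a]≡ℓ ⟩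
      ℓ + ℓ + (k ∸ (ℓ + ℓ))                        ≡⟨ m+[n∸m]≡n 2ℓ≤k ⟩
      k                                            ∎
      where open ≡-Reasoning

  Far : ℕ → V → V → Set
  Far q X Y = q * r < common X Y × common X Y + q * r < k

  far⇒longWalk : ∀ q {m X Y} → Far q X Y → Walk adj m X Y → suc q * 2 ≤ m
  far⇒longWalk q {m} (qr<s , s+qr<k) X⇝Y with evenOdd m
  ... | even t = *-monoˡ-≤ 2 (≰⇒> {t} {q} λ t≤q →
          <⇒≱ s+qr<k (≤-trans (evenWalk⇒k≤common+t*r t X⇝Y) (+-monoʳ-≤ _ (*-monoˡ-≤ r t≤q))))
  ... | odd t  = m≤n⇒m≤1+n (*-monoˡ-≤ 2 (≰⇒> {t} {q} λ t≤q →
          <⇒≱ qr<s (≤-trans (oddWalk⇒common≤t*r t X⇝Y) (*-monoˡ-≤ r t≤q))))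

  dist⇒far : ∀ q {X Y} → Dist adj X Y (suc (suc q) * 2) → Far (suc q) X Y
  dist⇒far q {X} {Y} (_ , noShorterWalk) =
    ≰⇒> (λ s≤[1+q]r → noShorterWalk _ (n<1+n _) (common≤t*r⇒oddWalk (suc q) s≤[1+q]r)) ,
    ≰⇒> (λ k≤s+[1+q]r → noShorterWalk _ (m<n⇒m<1+n (n<1+n _))
                                        (k≤common+[1+t]*r⇒evenWalk q {X} {Y} k≤s+[1+q]r))

  far⇒2[1+qr]≤k : ∀ q {X Y} → Far q X Y → suc (q * r) + suc (q * r) ≤ k
  far⇒2[1+qr]≤k q {X} {Y} (qr<s , s+qr<k) = begin
    suc (q * r) + suc (q * r)  ≤⟨ +-monoˡ-≤ (suc (q * r)) qr<s ⟩
    common X Y + suc (q * r)   ≡⟨ +-suc (common X Y) (q * r) ⟩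
    suc (common X Y + q * r)   ≤⟨ s+qr<k ⟩
    k                          ∎
    where open ≤-Reasoning

  2[1+qr]≤k : ∀ q → 2 ≤ k → ∃[ X ] ∃[ Y ] Dist adj X Y (suc q * 2) → suc (q * r) + suc (q * r) ≤ k
  2[1+qr]≤k zero    2≤k _              = 2≤k
  2[1+qr]≤k (suc q) _   (X , Y , dist) = far⇒2[1+qr]≤k (suc q) {X} {Y} (dist⇒far q dist)

dist≡2 : {V : Set} {G : V → V → Set} {x y z : V} → x ≢ y → ¬ G x y → G x z → G z y → Dist G x y 2
dist≡2 {G = G} {x} {y} x≢y x≁y x~z z~y = step x~z (step z~y here) , noShorterWalk
  where
  noShorterWalk : ∀ m → m < 2 → ¬ Walk G m x y
  noShorterWalk 0 _ here = x≢y refl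
  noShorterWalk 1 _ (step x~y here) = x≁y x~y
  noShorterWalk (suc (suc _)) (s≤s (s≤s ()))

module EvenDiameter (k r q : ℕ) (2≤k : 2 ≤ k) (diameter : IsDiameter (KAdj {2 * k + r} {k}) (suc q * 2))
  where

  open KneserGraph k r

  far⇒dist : ∀ {X Y} → Far q X Y → Dist adj X Y (suc q * 2)
  far⇒dist {X} {Y} far =
    let m , m≤D , dist = proj₁ diameter X Y
    in subst (Dist adj X Y) (≤-antisym m≤D (far⇒longWalk q far (proj₁ dist))) dist

  L : ℕ
  L = suc (q * r)

  2L≤k : L + L ≤ k
  2L≤k = 2[1+qr]≤k q 2≤k (proj₂ diameter)

  common≡L⇒far : ∀ {X Y} → common X Y ≡ L → Far q X Y
  common≡L⇒far X∩Y≡L rewrite X∩Y≡L = n<1+n (q * r) , <-≤-trans (+-monoʳ-< L (n<1+n (q * r))) 2L≤k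

  k≤2L+r : k ≤ L + L + r
  k≤2L+r = ≮⇒≥ λ 2L+r<k →
    let X = proj₁ (proj₂ diameter)
        C , X∩C≡L = vertexWithCommon X (≤-trans (m≤m+n L L) 2L≤k)
        X⇝C = proj₁ (far⇒dist (common≡L⇒far {X} {C} X∩C≡L))
    in <⇒≱ 2L+r<k (begin
      k                       ≤⟨ evenWalk⇒k≤common+t*r (suc q) {X} {C} X⇝C ⟩
      common X C + suc q * r  ≡⟨ cong (_+ suc q * r) X∩C≡L ⟩
      L + (r + q * r)         ≡⟨ cong (L +_) (+-comm r (q * r)) ⟩
      L + (q * r + r)         ≤⟨ +-monoʳ-≤ L (+-monoˡ-≤ r (n≤1+n (q * r))) ⟩
      L + (L + r)             ≡⟨ +-assoc L L r ⟨
      L + L + r               ∎)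
    where open ≤-Reasoning

  farMidpoint : ∀ A B → Σ[ C ∈ V ] Dist adj A C (suc q * 2) × Dist adj C B (suc q * 2)
  farMidpoint A B =
    let C , A∩C≡L , B∩C≡L = equidistantVertex A B 2L≤k k≤2L+r
    in C , far⇒dist (common≡L⇒far {A} {C} A∩C≡L) ,
           far⇒dist (common≡L⇒far {C} {B} (trans (common-comm C B) B∩C≡L))

  exactDist≡2 : ∀ A B → proj₁ A ≢ proj₁ B → ¬ ExactAdj adj (suc q * 2) A B →
                Dist (ExactAdj adj (suc q * 2)) A B 2
  exactDist≡2 A B A≢B A≁B =
    let C , A~C , C~B = farMidpoint A B in dist≡2 (A≢B ∘ cong proj₁) A≁B A~C C~B

mainTheorem6 : (k r D p : ℕ) → 2 ≤ k → 1 ≤ r → r < k ∸ 1 → ¬ (r ∣ k ∸ 1)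
    → IsDiameter (KAdj {2 * k + r} {k}) D → 1 ≤ p → D ≡ 2 * p
    → (A B : KVertex (2 * k + r) k) → proj₁ A ≢ proj₁ B
    → ¬ ExactAdj (KAdj {2 * k + r} {k}) (2 * p) A B
    → Dist (ExactAdj (KAdj {2 * k + r} {k}) (2 * p)) A B 2
mainTheorem6 k r D zero _ _ _ _ _ () _
mainTheorem6 k r .(2 * suc q) (suc q) 2≤k _ _ _ diameter _ refl A B rewrite *-comm 2 (suc q) =
  EvenDiameter.exactDist≡2 k r q 2≤k diameter A B
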